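{- Let $G$ be a finite simple graph with vertices numbered $1,\dots,n$. The family tree $\mathcal{F}(G)$ forms a tree.
   Context: For $S\subseteq V$, $G[S]$ is the induced subgraph, $N_S(u)=N(u)\cap S$. In $G[S]$, $a,b$ are comparable if $N_S(a)\subseteq N_S(b)$ or $N_S(b)\subseteq N_S(a)$; $u\in S$ is weak-simplicial in $G[S]$ if $N_S(u)$ is independent and any two vertices of $N_S(u)$ are comparable in $G[S]$. A graph is chordal bipartite if it is bipartite and has no induced cycle of length six or more. A solution is a set $X\subseteq V$ (possibly empty) such that $G[X]$ is chordal bipartite; $\mathcal{S}(G)$ is the set of solutions. $WS(X)$ is the set of weak-simplicial vertices of $G[X]$. For a nonempty solution $X$, the parent vertex is $pv(X)=\max WS(X)$ (maximum index) and the parent is $\mathrm{Par}(X)=X\setminus\{pv(X)\}$. The family tree $\mathcal{F}(G)$ is the directed graph with vertex set $\mathcal{S}(G)$ and an arc $(X,\mathrm{Par}(X))$ for each nonempty solution $X$. -}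

module Defs where

open import Data.Nat using (ℕ; suc; _≤_)
open import Data.Bool using (Bool)
open import Data.Fin using (Fin; toℕ)
open import Data.Fin.Subset using (Subset; _∈_; _-_; Nonempty) renaming (⊥ to ∅)
open import Data.Product using (Σ; ∃; _×_; _,_)
open import Data.Sum using (_⊎_)
open import Data.Empty using (⊥)
open import Relation.Nullary using (¬_; Dec)
open import Relation.Binary.PropositionalEquality using (_≡_; _≢_)
open import Relation.Binary.Construct.Closure.ReflexiveTransitive using (Star)
open import Function.Definitions using (Injective)
open import Function.Bundles using (_⇔_)

-- A finite simple graph on vertices Fin n (vertex i stands for i+1 of the paper;
-- the order of vertex indices is toℕ).
record SimpleGraph (n : ℕ) : Set₁ where
  field
    _~_   : Fin n → Fin n → Set
    ~-dec : ∀ u v → Dec (u ~ v)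
    ~-sym : ∀ {u v} → u ~ v → v ~ u
    ~-irr : ∀ {u} → ¬ (u ~ u)

module _ {n : ℕ} (G : SimpleGraph n) where
  open SimpleGraph G

  Comparable : Subset n → Fin n → Fin n → Set
  Comparable S a b =
      (∀ x → x ∈ S → a ~ x → b ~ x)
    ⊎ (∀ x → x ∈ S → b ~ x → a ~ x)

  WeakSimplicial : Subset n → Fin n → Set
  WeakSimplicial S u =
      u ∈ S
    × (∀ a b → a ∈ S → u ~ a → b ∈ S → u ~ b → ¬ (a ~ b))
    × (∀ a b → a ∈ S → u ~ a → b ∈ S → u ~ b → Comparable S a b)

  Bipartite : Subset n → Set
  Bipartite S = Σ (Fin n → Bool) λ col →
    ∀ u v → u ∈ S → v ∈ S → u ~ v → col u ≢ col v

  CycSucc : (k : ℕ) → Fin k → Fin k → Set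
  CycSucc k i j = (suc (toℕ i) ≡ toℕ j) ⊎ ((suc (toℕ i) ≡ k) × (toℕ j ≡ 0))

  InducedCycle : Subset n → (k : ℕ) → Set
  InducedCycle S k = Σ (Fin k → Fin n) λ c →
      Injective _≡_ _≡_ c
    × (∀ i → c i ∈ S)
    × (∀ i j → (c i ~ c j) ⇔ (CycSucc k i j ⊎ CycSucc k j i))

  ChordalBipartite : Subset n → Set
  ChordalBipartite S = Bipartite S × ¬ (Σ ℕ λ k → (6 ≤ k) × InducedCycle S k)

  Solution : Subset n → Set
  Solution = ChordalBipartite

  IsParentVertex : Subset n → Fin n → Set
  IsParentVertex X v = WeakSimplicial X v × (∀ w → WeakSimplicial X w → toℕ w ≤ toℕ v)

  FTArc : Subset n → Subset n → Set
  FTArc X Y = Solution X × Nonempty X × Σ (Fin n) λ v → IsParentVertex X v × (Y ≡ X - v)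

-- A directed graph (vertex predicate V, arc relation Arc) is a tree rooted at r
-- (all arcs pointing towards the root, i.e. an in-arborescence).
record IsRootedTree {A : Set} (V : A → Set) (Arc : A → A → Set) (r : A) : Set where
  field
    root∈       : V r
    arc-src     : ∀ {x y} → Arc x y → V x
    arc-tgt     : ∀ {x y} → Arc x y → V y
    root-sink   : ∀ {y} → ¬ Arc r y
    out-exists  : ∀ x → V x → x ≢ r → ∃ λ y → Arc x y
    out-unique  : ∀ {x y z} → Arc x y → Arc x z → y ≡ z
    reach-root  : ∀ x → V x → Star Arc x r

FamilyTreeIsTree : {n : ℕ} → SimpleGraph n → Set
FamilyTreeIsTree {n} G = IsRootedTree (Solution G) (FTArc G) ∅

module Submission where

-- Every arc X → X − pv(X) deletes a vertex, so following arcs from a solution strictly shrinks it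
-- and must end in ∅, while pv(X), a maximum, is unique. The substance is that a nonempty chordal
-- bipartite graph always has a weak-simplicial vertex. With a proper 2-colouring fixed, this is
-- proved in a stronger form by induction on S: for non-adjacent a, b ∈ S of different colours,
-- some weak-simplicial vertex of G[S] of b's colour is reachable from b in G[S ∖ N[a]]. Let K be
-- that component. If S has vertices outside {a} ∪ K ∪ N(K), recurse on that set. Otherwise pick
-- a′ ∈ K of a's colour maximising |N(a) ∩ N(a′)|. If a′ missed some p ∈ N(a), the vertex u before
-- p on an induced path from a′ to p through K would be another such candidate, and u sees every
-- q ∈ N(a) ∩ N(a′): the last contact of q with the path must be u, as any other closes an odd
-- cycle or an induced cycle of length ≥ 6 through a. With p this contradicts maximality.
-- Now either some vertex of K of b's colour misses a′, and we recurse on S − a from a′ and that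
-- vertex, or a′ sees the whole other colour class, and we recurse on S − a′: adding back such a
-- vertex preserves weak-simpliciality.

open import Defs
open import Data.Nat using (ℕ; zero; suc; _+_; _≤_; _<_; z≤n; s≤s; _≤?_; _<?_; s≤s⁻¹; anyUpTo?)
open import Data.Nat.Properties
open import Data.Nat.Induction using (<-wellFounded)
open import Algebra.Properties.CommutativeSemigroup +-commutativeSemigroup using (xy∙z≈xz∙y)
open import Data.Bool using (Bool; true)
import Data.Bool as Bool
open import Data.Bool.Properties using (¬-not)
open import Data.Fin using (Fin; toℕ; zero; suc)
import Data.Fin.Properties as Fin
open import Data.Fin.Subset using (Subset; _∈_; _∉_; _-_; _⊆_; _⊂_; ⁅_⁆; ∣_∣; Nonempty) renaming (⊥ to ∅)
open import Data.Fin.Subset.Properties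
  using (_∈?_; x∈p∧x≢y⇒x∈p-y; p⊂q⇒∣p∣<∣q∣; x∈p⇒p-x⊂p; p─q⊆p; ∉⊥; nonempty?; Empty-unique; drop-there)
open import Data.Fin.Subset.Induction using (⊂-wellFounded)
open import Data.List using (List; filter; allFin)
open import Data.List.Extrema.Nat using (argmax; argmax-all; f[xs]≤f[argmax])
import Data.List.Relation.Unary.All as All
open import Data.List.Relation.Unary.All.Properties using (all-filter)
open import Data.List.Membership.Propositional.Properties using (∈-filter⁺; ∈-allFin)
open import Data.Vec using (tabulate; _∷_)
open import Data.Vec.Properties using (lookup⇒[]=; []=⇒lookup; lookup∘tabulate)
open import Data.Product using (Σ; Σ-syntax; ∃; ∃-syntax; _×_; _,_; proj₁; proj₂; uncurry)
open import Data.Sum using (_⊎_; inj₁; inj₂)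
import Data.Sum as Sum
open import Data.Empty using (⊥; ⊥-elim)
open import Function using (_∘_)
open import Function.Bundles using (_⇔_; mk⇔; Equivalence)
open import Induction.WellFounded using (Acc; acc)
open import Relation.Nullary using (¬_; Dec; yes; no; does)
open import Relation.Nullary.Decidable using (dec-true; _×-dec_; _⊎-dec_; _→-dec_; ¬?)
import Relation.Nullary.Decidable as Dec
open import Relation.Unary using (Decidable)
open import Relation.Binary.PropositionalEquality
open import Relation.Binary.Definitions using (tri<; tri≈; tri>)
open import Relation.Binary.Construct.Closure.ReflexiveTransitive using (Star; ε; _◅_)

≢-≢⇒≡ : {a b c : Bool} → a ≢ b → b ≢ c → a ≡ c
≢-≢⇒≡ a≢b b≢c = trans (¬-not a≢b) (sym (¬-not (b≢c ∘ sym)))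

x∉p-x : ∀ {n} (p : Subset n) (x : Fin n) → x ∉ p - x
x∉p-x (s ∷ p) zero ()
x∉p-x (s ∷ p) (suc x) x∈ = x∉p-x p x (drop-there x∈)

module _ {n : ℕ} where

  subsetOf : {P : Fin n → Set} → Decidable P → Subset n
  subsetOf P? = tabulate (λ x → does (P? x))

  ∈-subsetOf⁺ : {P : Fin n → Set} (P? : Decidable P) {x : Fin n} → P x → x ∈ subsetOf P?
  ∈-subsetOf⁺ P? {x} px = lookup⇒[]= x _ (trans (lookup∘tabulate _ x) (dec-true (P? x) px))

  ∈-subsetOf⁻ : {P : Fin n → Set} (P? : Decidable P) {x : Fin n} → x ∈ subsetOf P? → P x
  ∈-subsetOf⁻ P? {x} x∈ with P? x | trans (sym (lookup∘tabulate _ x)) ([]=⇒lookup x∈)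
  ... | yes px | _ = px
  ... | no _   | ()

  p-x⊆p : (p : Subset n) {x : Fin n} → p - x ⊆ p
  p-x⊆p p {x} = p─q⊆p p ⁅ x ⁆

  x∈p-y⇒x≢y : (p : Subset n) {x y : Fin n} → x ∈ p - y → x ≢ y
  x∈p-y⇒x≢y p {x} x∈ refl = x∉p-x p x x∈

  argmax-Fin : {P : Fin n → Set} → Decidable P → (f : Fin n → ℕ) → ∃ P →
               Σ[ x ∈ Fin n ] P x × (∀ y → P y → f y ≤ f x)
  argmax-Fin P? f (x₀ , px₀) =
      best
    , argmax-all f px₀ (all-filter P? (allFin n))
    , λ y py → All.lookup (f[xs]≤f[argmax] x₀ candidates) (∈-filter⁺ P? (∈-allFin y) py)
    where
    candidates : List (Fin n)
    candidates = filter P? (allFin n)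
    best : Fin n
    best = argmax f x₀ candidates

lastUpTo : {P : ℕ → Set} → Decidable P → ∀ r → P 0 →
           Σ[ i ∈ ℕ ] i ≤ r × P i × (∀ t → i < t → t ≤ r → ¬ P t)
lastUpTo P? zero p0 = 0 , z≤n , p0 , λ t 0<t t≤0 → ⊥-elim (<⇒≱ 0<t t≤0)
lastUpTo {P} P? (suc r) p0 with P? (suc r)
... | yes pr = suc r , ≤-refl , pr , λ t r<t t≤r → ⊥-elim (<⇒≱ r<t t≤r)
... | no ¬pr with lastUpTo P? r p0
...   | i , i≤r , pi , none = i , m≤n⇒m≤1+n i≤r , pi , none′
  where
  none′ : ∀ t → i < t → t ≤ suc r → ¬ P t
  none′ t i<t t≤ with t ≟ suc r
  ... | yes refl = ¬pr
  ... | no t≢ = none t i<t (s≤s⁻¹ (≤∧≢⇒< t≤ t≢))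

_◃_ : {A : Set} → A → (ℕ → A) → ℕ → A
(x ◃ v) zero = x
(x ◃ v) (suc t) = v t

module Reachability {n : ℕ} (G : SimpleGraph n) where
  open SimpleGraph G

  data Reach (T : Subset n) : Fin n → Fin n → Set where
    here : ∀ {x} → x ∈ T → Reach T x x
    step : ∀ {x y z} → x ∈ T → x ~ y → Reach T y z → Reach T x z

  module _ {T : Subset n} where

    Reach-source∈ : ∀ {x y} → Reach T x y → x ∈ T
    Reach-source∈ (here x∈) = x∈
    Reach-source∈ (step x∈ _ _) = x∈

    Reach-target∈ : ∀ {x y} → Reach T x y → y ∈ T
    Reach-target∈ (here y∈) = y∈
    Reach-target∈ (step _ _ r) = Reach-target∈ r

    Reach-trans : ∀ {x y z} → Reach T x y → Reach T y z → Reach T x z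
    Reach-trans (here _) r′ = r′
    Reach-trans (step x∈ xy r) r′ = step x∈ xy (Reach-trans r r′)

    Reach-snoc : ∀ {x y z} → Reach T x y → y ~ z → z ∈ T → Reach T x z
    Reach-snoc r yz z∈ = Reach-trans r (step (Reach-target∈ r) yz (here z∈))

    Reach-sym : ∀ {x y} → Reach T x y → Reach T y x
    Reach-sym (here x∈) = here x∈
    Reach-sym (step x∈ xy r) = Reach-snoc (Reach-sym r) (~-sym xy) x∈

  Reach-mono : ∀ {T U} → T ⊆ U → ∀ {x y} → Reach T x y → Reach U x y
  Reach-mono T⊆U (here x∈) = here (T⊆U x∈)
  Reach-mono T⊆U (step x∈ xy r) = step (T⊆U x∈) xy (Reach-mono T⊆U r)

  Reach-lastExit : ∀ {T u y} (x : Fin n) → Reach T u y →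
                   Reach (T - x) u y ⊎ (Σ[ z ∈ Fin n ] x ~ z × Reach (T - x) z y) ⊎ y ≡ x
  Reach-lastExit {u = u} x (here u∈) with u Fin.≟ x
  ... | yes refl = inj₂ (inj₂ refl)
  ... | no u≢x = inj₁ (here (x∈p∧x≢y⇒x∈p-y u∈ u≢x))
  Reach-lastExit {u = u} x (step {y = u′} u∈ uu′ r) with Reach-lastExit x r
  ... | inj₂ exit = inj₂ exit
  ... | inj₁ r′ with u Fin.≟ x
  ...   | yes refl = inj₂ (inj₁ (u′ , uu′ , r′))
  ...   | no u≢x = inj₁ (step (x∈p∧x≢y⇒x∈p-y u∈ u≢x) uu′ r′)

  Reach-leave : ∀ {T x y} → Reach T x y → x ≢ y → Σ[ z ∈ Fin n ] x ~ z × Reach (T - x) z y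
  Reach-leave {T} {x} r x≢y with Reach-lastExit x r
  ... | inj₁ r′ = ⊥-elim (x∈p-y⇒x≢y T (Reach-source∈ r′) refl)
  ... | inj₂ (inj₁ exit) = exit
  ... | inj₂ (inj₂ y≡x) = ⊥-elim (x≢y (sym y≡x))

  Reach? : ∀ (T : Subset n) → Acc _⊂_ T → ∀ x y → Dec (Reach T x y)
  Reach? T (acc smaller) x y with x ∈? T
  ... | no x∉ = no (x∉ ∘ Reach-source∈)
  ... | yes x∈ with x Fin.≟ y
  ...   | yes refl = yes (here x∈)
  ...   | no x≢y = Dec.map′ enter (λ r → Reach-leave r x≢y)
                     (Fin.any? λ z → ~-dec x z ×-dec Reach? (T - x) (smaller (x∈p⇒p-x⊂p x∈)) z y)
    where
    enter : (Σ[ z ∈ Fin n ] x ~ z × Reach (T - x) z y) → Reach T x y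
    enter (z , xz , r) = step x∈ xz (Reach-mono (p-x⊆p T) r)

module InducedPaths {n : ℕ} (G : SimpleGraph n) where
  open SimpleGraph G

  record InducedPath (m : ℕ) (v : ℕ → Fin n) : Set where
    field
      consecutive : ∀ {i} → i < m → v i ~ v (suc i)
      chordless   : ∀ {i j} → j ≤ m → suc i < j → ¬ (v i ~ v j)
      injective   : ∀ {i j} → j ≤ m → i < j → v i ≢ v j

  open InducedPath

  module _ {m : ℕ} {v : ℕ → Fin n} (P : InducedPath m v) where

    InducedPath-drop : ∀ i {k} → i + k ≡ m → InducedPath k (λ t → v (i + t))
    InducedPath-drop i {k} i+k≡m = record
      { consecutive = λ {t} t<k → subst (λ u → v (i + t) ~ v u) (sym (+-suc i t)) (consecutive P (shift< t<k))
      ; chordless = λ {s} {t} t≤k 1+s<t →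
          chordless P (shift≤ t≤k) (subst (_< i + t) (+-suc i s) (+-monoʳ-< i 1+s<t))
      ; injective = λ {s} {t} t≤k s<t → injective P (shift≤ t≤k) (+-monoʳ-< i s<t) }
      where
      shift≤ : ∀ {t} → t ≤ k → i + t ≤ m
      shift≤ {t} t≤k = subst (i + t ≤_) i+k≡m (+-monoʳ-≤ i t≤k)
      shift< : ∀ {t} → t < k → i + t < m
      shift< {t} t<k = subst (_≤ m) (+-suc i t) (shift≤ t<k)

    InducedPath-◃ : ∀ {x} → x ~ v 0 → (∀ t → 0 < t → t ≤ m → ¬ (x ~ v t)) → (∀ t → t ≤ m → x ≢ v t) →
                    InducedPath (suc m) (x ◃ v)
    InducedPath-◃ {x} x~first x≁rest x≢ = record
      { consecutive = cons-consecutive ; chordless = cons-chordless ; injective = cons-injective }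
      where
      cons-consecutive : ∀ {i} → i < suc m → (x ◃ v) i ~ (x ◃ v) (suc i)
      cons-consecutive {zero} _ = x~first
      cons-consecutive {suc i} i<m = consecutive P (s≤s⁻¹ i<m)
      cons-chordless : ∀ {i j} → j ≤ suc m → suc i < j → ¬ ((x ◃ v) i ~ (x ◃ v) j)
      cons-chordless {zero} {suc j} j≤m 1<j = x≁rest j (s≤s⁻¹ 1<j) (s≤s⁻¹ j≤m)
      cons-chordless {suc i} {suc j} j≤m 2+i<j = chordless P (s≤s⁻¹ j≤m) (s≤s⁻¹ 2+i<j)
      cons-injective : ∀ {i j} → j ≤ suc m → i < j → (x ◃ v) i ≢ (x ◃ v) j
      cons-injective {zero} {suc j} j≤m _ = x≢ j (s≤s⁻¹ j≤m)
      cons-injective {suc i} {suc j} j≤m i<j = injective P (s≤s⁻¹ j≤m) (s≤s⁻¹ i<j)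

    InducedPath-~⇔ : ∀ {s t} → s ≤ m → t ≤ m → v s ~ v t ⇔ (suc s ≡ t ⊎ suc t ≡ s)
    InducedPath-~⇔ {s} {t} s≤m t≤m = mk⇔ to from
      where
      to : v s ~ v t → suc s ≡ t ⊎ suc t ≡ s
      to st with <-cmp s t
      ... | tri≈ _ refl _ = ⊥-elim (~-irr st)
      ... | tri< s<t _ _ with suc s ≟ t
      ...   | yes 1+s≡t = inj₁ 1+s≡t
      ...   | no 1+s≢t = ⊥-elim (chordless P t≤m (≤∧≢⇒< s<t 1+s≢t) st)
      to st | tri> _ _ t<s with suc t ≟ s
      ...   | yes 1+t≡s = inj₂ 1+t≡s
      ...   | no 1+t≢s = ⊥-elim (chordless P s≤m (≤∧≢⇒< t<s 1+t≢s) (~-sym st))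
      from : suc s ≡ t ⊎ suc t ≡ s → v s ~ v t
      from (inj₁ refl) = consecutive P t≤m
      from (inj₂ refl) = ~-sym (consecutive P s≤m)

    InducedPath-index-injective : ∀ {s t} → s ≤ m → t ≤ m → v s ≡ v t → s ≡ t
    InducedPath-index-injective {s} {t} s≤m t≤m same with <-cmp s t
    ... | tri< s<t _ _ = ⊥-elim (injective P t≤m s<t same)
    ... | tri≈ _ s≡t _ = s≡t
    ... | tri> _ _ t<s = ⊥-elim (injective P s≤m t<s (sym same))

  closeInducedPath : ∀ {S : Subset n} {m v z} → InducedPath m v → (∀ t → t ≤ m → v t ∈ S) → z ∈ S →
                     z ~ v 0 → z ~ v m → (∀ t → 0 < t → t < m → ¬ (z ~ v t)) → (∀ t → t ≤ m → z ≢ v t) →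
                     InducedCycle G S (suc (suc m))
  closeInducedPath {S} {m} {v} {z} P v∈ z∈ z~first z~last z≁inner z≢ = c , c-injective , c-∈ , c-~⇔
    where
    k : ℕ
    k = suc (suc m)

    c : Fin k → Fin n
    c i = (z ◃ v) (toℕ i)

    index≤ : (i : Fin (suc m)) → toℕ i ≤ m
    index≤ i = s≤s⁻¹ (Fin.toℕ<n i)

    c-injective : ∀ {i j} → c i ≡ c j → i ≡ j
    c-injective {zero} {zero} _ = refl
    c-injective {zero} {suc j} same = ⊥-elim (z≢ (toℕ j) (index≤ j) same)
    c-injective {suc i} {zero} same = ⊥-elim (z≢ (toℕ i) (index≤ i) (sym same))
    c-injective {suc i} {suc j} same =
      cong suc (Fin.toℕ-injective (InducedPath-index-injective P (index≤ i) (index≤ j) same))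

    c-∈ : ∀ i → c i ∈ S
    c-∈ zero = z∈
    c-∈ (suc i) = v∈ (toℕ i) (index≤ i)

    z~⇔ : ∀ j → (z ~ v (toℕ j)) ⇔ (CycSucc G k zero (suc j) ⊎ CycSucc G k (suc j) zero)
    z~⇔ j = mk⇔ to from
      where
      to : z ~ v (toℕ j) → CycSucc G k zero (suc j) ⊎ CycSucc G k (suc j) zero
      to zt with toℕ j ≟ 0 | toℕ j ≟ m
      ... | yes t≡0 | _ = inj₁ (inj₁ (cong suc (sym t≡0)))
      ... | no _ | yes t≡m = inj₂ (inj₂ (cong (λ t → suc (suc t)) t≡m , refl))
      ... | no t≢0 | no t≢m = ⊥-elim (z≁inner (toℕ j) (n≢0⇒n>0 t≢0) (≤∧≢⇒< (index≤ j) t≢m) zt)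
      from : CycSucc G k zero (suc j) ⊎ CycSucc G k (suc j) zero → z ~ v (toℕ j)
      from (inj₁ (inj₁ 1≡1+t)) = subst (λ u → z ~ v u) (suc-injective 1≡1+t) z~first
      from (inj₁ (inj₂ (() , _)))
      from (inj₂ (inj₁ ()))
      from (inj₂ (inj₂ (2+t≡k , _))) = subst (λ u → z ~ v u) (sym (suc-injective (suc-injective 2+t≡k))) z~last

    path~⇔ : ∀ i j → (v (toℕ i) ~ v (toℕ j)) ⇔ (CycSucc G k (suc i) (suc j) ⊎ CycSucc G k (suc j) (suc i))
    path~⇔ i j =
      mk⇔ (Sum.map (inj₁ ∘ cong suc) (inj₁ ∘ cong suc) ∘ Equivalence.to path⇔) (Equivalence.from path⇔ ∘ from)
      where
      path⇔ : v (toℕ i) ~ v (toℕ j) ⇔ (suc (toℕ i) ≡ toℕ j ⊎ suc (toℕ j) ≡ toℕ i)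
      path⇔ = InducedPath-~⇔ P (index≤ i) (index≤ j)
      from : CycSucc G k (suc i) (suc j) ⊎ CycSucc G k (suc j) (suc i) → suc (toℕ i) ≡ toℕ j ⊎ suc (toℕ j) ≡ toℕ i
      from (inj₁ (inj₁ e)) = inj₁ (suc-injective e)
      from (inj₁ (inj₂ (_ , ())))
      from (inj₂ (inj₁ e)) = inj₂ (suc-injective e)
      from (inj₂ (inj₂ (_ , ())))

    c-~⇔ : ∀ i j → (c i ~ c j) ⇔ (CycSucc G k i j ⊎ CycSucc G k j i)
    c-~⇔ zero zero = mk⇔ (⊥-elim ∘ ~-irr)
      λ { (inj₁ (inj₁ ())) ; (inj₁ (inj₂ (() , _))) ; (inj₂ (inj₁ ())) ; (inj₂ (inj₂ (() , _))) }
    c-~⇔ zero (suc j) = z~⇔ j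
    c-~⇔ (suc i) zero =
      mk⇔ (Sum.swap ∘ Equivalence.to (z~⇔ i) ∘ ~-sym) (~-sym ∘ Equivalence.from (z~⇔ i) ∘ Sum.swap)
    c-~⇔ (suc i) (suc j) = path~⇔ i j

module Walks {n : ℕ} (G : SimpleGraph n) where
  open SimpleGraph G
  open Reachability G
  open InducedPaths G using (InducedPath)

  record Walk (T : Subset n) (s e : Fin n) : Set where
    field
      len    : ℕ
      at     : ℕ → Fin n
      at-0   : at 0 ≡ s
      at-len : at len ≡ e
      at-∈   : ∀ t → t < len → at t ∈ T
      at-~   : ∀ t → t < len → at t ~ at (suc t)
  open Walk public

  module _ {T : Subset n} where

    cons : ∀ {x s e} → x ∈ T → x ~ s → Walk T s e → Walk T x e
    cons {x} x∈ xs W = record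
      { len = suc (len W) ; at = x ◃ at W ; at-0 = refl ; at-len = at-len W
      ; at-∈ = λ { zero _ → x∈ ; (suc t) t< → at-∈ W t (s≤s⁻¹ t<) }
      ; at-~ = λ { zero _ → subst (x ~_) (sym (at-0 W)) xs ; (suc t) t< → at-~ W t (s≤s⁻¹ t<) } }

    Reach⇒Walk : ∀ {x y e} → Reach T x y → y ~ e → Walk T x e
    Reach⇒Walk {x} {e = e} (here x∈) xe = record
      { len = 1 ; at = x ◃ λ _ → e ; at-0 = refl ; at-len = refl
      ; at-∈ = λ { zero _ → x∈ ; (suc _) (s≤s ()) } ; at-~ = λ { zero _ → xe ; (suc _) (s≤s ()) } }
    Reach⇒Walk (step x∈ xy r) ye = cons x∈ xy (Reach⇒Walk r ye)

    Walk⇒Reach : ∀ {s e} (W : Walk T s e) t → t < len W → Reach T s (at W t)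
    Walk⇒Reach W zero 0<len = subst (λ v → Reach T v (at W 0)) (at-0 W) (here (at-∈ W 0 0<len))
    Walk⇒Reach W (suc t) t<len =
      Reach-snoc (Walk⇒Reach W t t<len′) (at-~ W t t<len′) (at-∈ W (suc t) t<len)
      where
      t<len′ : t < len W
      t<len′ = <-trans (n<1+n t) t<len

    truncate : ∀ {s e} (W : Walk T s e) t → t < len W → at W t ≡ e → Walk T s e
    truncate W t t<len at-t = record
      { len = t ; at = at W ; at-0 = at-0 W ; at-len = at-t
      ; at-∈ = λ i i<t → at-∈ W i (<-trans i<t t<len)
      ; at-~ = λ i i<t → at-~ W i (<-trans i<t t<len) }

    jumping : (ℕ → Fin n) → ℕ → ℕ → ℕ → Fin n
    jumping v a d i with i ≤? a
    ... | yes _ = v i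
    ... | no _ = v (i + d)

    jumping-≤ : ∀ v a d {i} → i ≤ a → jumping v a d i ≡ v i
    jumping-≤ v a d {i} i≤a with i ≤? a
    ... | yes _ = refl
    ... | no i≰a = ⊥-elim (i≰a i≤a)

    jumping-> : ∀ v a d {i} → a < i → jumping v a d i ≡ v (i + d)
    jumping-> v a d {i} a<i with i ≤? a
    ... | yes i≤a = ⊥-elim (<⇒≱ a<i i≤a)
    ... | no _ = refl

    skip : ∀ {s e} (W : Walk T s e) a d L → a < L → len W ≡ L + d →
           at W a ~ at W (suc a + d) → Walk T s e
    skip {s} {e} W a d L a<L len≡ shortcut = record
      { len = L ; at = jumping (at W) a d
      ; at-0 = trans (jumping-≤ (at W) a d z≤n) (at-0 W)
      ; at-len = trans (jumping-> (at W) a d a<L) (trans (cong (at W) (sym len≡)) (at-len W))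
      ; at-∈ = at′-∈ ; at-~ = at′-~ }
      where
      shifted< : ∀ {i} → i < L → i + d < len W
      shifted< {i} i<L = subst (i + d <_) (sym len≡) (+-monoˡ-< d i<L)

      at′-∈ : ∀ i → i < L → jumping (at W) a d i ∈ T
      at′-∈ i i<L with i ≤? a
      ... | yes _ = at-∈ W i (≤-<-trans (m≤m+n i d) (shifted< i<L))
      ... | no _ = at-∈ W (i + d) (shifted< i<L)

      at′-~ : ∀ i → i < L → jumping (at W) a d i ~ jumping (at W) a d (suc i)
      at′-~ i i<L with <-cmp i a
      ... | tri< i<a _ _ =
        subst₂ _~_ (sym (jumping-≤ (at W) a d (<⇒≤ i<a))) (sym (jumping-≤ (at W) a d i<a))
          (at-~ W i (≤-<-trans (m≤m+n i d) (≤-<-trans (+-monoˡ-≤ d (<⇒≤ i<a)) (shifted< a<L))))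
      ... | tri≈ _ refl _ =
        subst₂ _~_ (sym (jumping-≤ (at W) a d ≤-refl)) (sym (jumping-> (at W) a d ≤-refl)) shortcut
      ... | tri> _ _ a<i =
        subst₂ _~_ (sym (jumping-> (at W) a d a<i)) (sym (jumping-> (at W) a d (m<n⇒m<1+n a<i)))
          (at-~ W (i + d) (shifted< i<L))

    Shorter : ∀ {s e} → Walk T s e → Set
    Shorter {s} {e} W = Σ[ W′ ∈ Walk T s e ] len W′ < len W

    jump : ∀ {s e} (W : Walk T s e) {a b} → suc a < b → b ≤ len W → at W a ~ at W b → Shorter W
    jump W {a} 2+a≤b b≤len ab with m≤n⇒∃[o]m+o≡n 2+a≤b | m≤n⇒∃[o]m+o≡n b≤len
    ... | g , refl | r , b+r≡len =
        skip W a (suc g) (suc a + r) (s≤s (m≤m+n a r)) len≡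
          (subst (at W a ~_) (cong (at W) (sym (+-suc (suc a) g))) ab)
      , subst (suc a + r <_) (sym len≡) (m<m+n (suc a + r) (s≤s z≤n))
      where
      open ≡-Reasoning
      len≡ : len W ≡ suc a + r + suc g
      len≡ = begin
        len W                ≡⟨ sym b+r≡len ⟩
        suc (suc a) + g + r  ≡⟨ cong (_+ r) (sym (+-suc (suc a) g)) ⟩
        suc a + suc g + r    ≡⟨ xy∙z≈xz∙y (suc a) (suc g) r ⟩
        suc a + r + suc g    ∎

    Repeat : ∀ {s e} → Walk T s e → Set
    Repeat W = ∃[ b ] b < suc (len W) × ∃[ a ] a < b × at W a ≡ at W b

    Chord : ∀ {s e} → Walk T s e → Set
    Chord W = ∃[ b ] b < suc (len W) × ∃[ a ] a < b × suc a < b × at W a ~ at W b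

    repeat? : ∀ {s e} (W : Walk T s e) → Dec (Repeat W)
    repeat? W = anyUpTo? (λ b → anyUpTo? (λ a → at W a Fin.≟ at W b) b) (suc (len W))

    chord? : ∀ {s e} (W : Walk T s e) → Dec (Chord W)
    chord? W = anyUpTo? (λ b → anyUpTo? (λ a → suc a <? b ×-dec ~-dec (at W a) (at W b)) b) (suc (len W))

    removeRepeat : ∀ {s e} (W : Walk T s e) → Repeat W → Shorter W
    removeRepeat W (b , b≤len , a , a<b , same) with m≤n⇒m<n∨m≡n (s≤s⁻¹ b≤len)
    ... | inj₂ refl = truncate W a a<b (trans same (at-len W)) , a<b
    ... | inj₁ b<len = jump W (s≤s a<b) b<len (subst (_~ at W (suc b)) (sym same) (at-~ W b b<len))

    removeChord : ∀ {s e} (W : Walk T s e) → Chord W → Shorter W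
    removeChord W (b , b≤len , a , _ , 1+a<b , ab) = jump W 1+a<b (s≤s⁻¹ b≤len) ab

    induced : ∀ {s e} (W : Walk T s e) → ¬ Repeat W → ¬ Chord W → InducedPath (len W) (at W)
    induced W noRepeat noChord = record
      { consecutive = λ {i} → at-~ W i
      ; chordless = λ {i} {j} j≤len 1+i<j ij →
          noChord (j , s≤s j≤len , i , <-trans (n<1+n i) 1+i<j , 1+i<j , ij)
      ; injective = λ {i} {j} j≤len i<j same → noRepeat (j , s≤s j≤len , i , i<j , same) }

    shortenOrInduced : ∀ {s e} (W : Walk T s e) → Shorter W ⊎ InducedPath (len W) (at W)
    shortenOrInduced W with repeat? W | chord? W
    ... | yes rep | _ = inj₁ (removeRepeat W rep)
    ... | no _ | yes ch = inj₁ (removeChord W ch)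
    ... | no ¬rep | no ¬ch = inj₂ (induced W ¬rep ¬ch)

    inducedWalk : ∀ {s e} (W : Walk T s e) → Acc _<_ (len W) →
                  Σ[ W′ ∈ Walk T s e ] InducedPath (len W′) (at W′)
    inducedWalk W (acc shorter) with shortenOrInduced W
    ... | inj₁ (W′ , W′<W) = inducedWalk W′ (shorter W′<W)
    ... | inj₂ ind = W , ind

module _ {n : ℕ} (G : SimpleGraph n) where
  open SimpleGraph G

  WeakSimplicial-lift : ∀ {S S′ w} → S′ ⊆ S →
                        (∀ x → x ∈ S → w ~ x → x ∈ S′) →
                        (∀ c x → c ∈ S → w ~ c → x ∈ S → c ~ x → x ∈ S′) →
                        WeakSimplicial G S′ w → WeakSimplicial G S w
  WeakSimplicial-lift {S} {S′} {w} S′⊆S N⊆S′ N²⊆S′ (w∈ , independent , comparable) =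
    S′⊆S w∈ , (λ x y x∈ wx y∈ wy → independent x y (N⊆S′ x x∈ wx) wx (N⊆S′ y y∈ wy) wy) , comparable′
    where
    comparable′ : ∀ x y → x ∈ S → w ~ x → y ∈ S → w ~ y → Comparable G S x y
    comparable′ x y x∈ wx y∈ wy with comparable x y (N⊆S′ x x∈ wx) wx (N⊆S′ y y∈ wy) wy
    ... | inj₁ Nx⊆Ny = inj₁ (λ z z∈ xz → Nx⊆Ny z (N²⊆S′ x z x∈ wx z∈ xz) xz)
    ... | inj₂ Ny⊆Nx = inj₂ (λ z z∈ yz → Ny⊆Nx z (N²⊆S′ y z y∈ wy z∈ yz) yz)

  NoLongInducedCycle : Subset n → Set
  NoLongInducedCycle S = ¬ (Σ ℕ λ k → (6 ≤ k) × InducedCycle G S k)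

  NoLongInducedCycle-⊆ : ∀ {S S′} → S′ ⊆ S → NoLongInducedCycle S → NoLongInducedCycle S′
  NoLongInducedCycle-⊆ S′⊆S noHole (k , 6≤k , c , c-inj , c∈ , c~) = noHole (k , 6≤k , c , c-inj , S′⊆S ∘ c∈ , c~)

  WeakSimplicial-isolated : ∀ {S w} → w ∈ S → (∀ x → x ∈ S → ¬ (w ~ x)) → WeakSimplicial G S w
  WeakSimplicial-isolated w∈ isolated =
    w∈ , (λ x _ x∈ wx _ _ → ⊥-elim (isolated x x∈ wx)) , (λ x _ x∈ wx _ _ → ⊥-elim (isolated x x∈ wx))

  Comparable? : ∀ S x y → Dec (Comparable G S x y)
  Comparable? S x y = Fin.all? (λ z → (z ∈? S) →-dec (~-dec x z →-dec ~-dec y z))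
               ⊎-dec Fin.all? (λ z → (z ∈? S) →-dec (~-dec y z →-dec ~-dec x z))

  WeakSimplicial? : ∀ S → Decidable (WeakSimplicial G S)
  WeakSimplicial? S u = (u ∈? S) ×-dec (onPairs (λ x y → ¬? (~-dec x y)) ×-dec onPairs (Comparable? S))
    where
    onPairs : {R : Fin n → Fin n → Set} → (∀ x y → Dec (R x y)) →
              Dec (∀ x y → x ∈ S → u ~ x → y ∈ S → u ~ y → R x y)
    onPairs R? = Fin.all? λ x → Fin.all? λ y →
      (x ∈? S) →-dec (~-dec u x →-dec ((y ∈? S) →-dec (~-dec u y →-dec R? x y)))

module Colouring {n : ℕ} (G : SimpleGraph n) (col : Fin n → Bool) where
  open SimpleGraph G
  open Reachability G
  open Walks G
  open InducedPaths G

  ProperColouring : Subset n → Set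
  ProperColouring S = ∀ u v → u ∈ S → v ∈ S → u ~ v → col u ≢ col v

  ProperColouring-⊆ : ∀ {S S′} → S′ ⊆ S → ProperColouring S → ProperColouring S′
  ProperColouring-⊆ S′⊆S proper u v u∈ v∈ = proper u v (S′⊆S u∈) (S′⊆S v∈)

  module _ {S : Subset n} (proper : ProperColouring S) where

    opposite : ∀ {x y} → x ∈ S → y ∈ S → x ~ y → col y ≢ col x
    opposite x∈ y∈ xy = proper _ _ x∈ y∈ xy ∘ sym

    sameColour : ∀ {w x y} → w ∈ S → x ∈ S → y ∈ S → w ~ x → w ~ y → col x ≡ col y
    sameColour w∈ x∈ y∈ wx wy = ≢-≢⇒≡ (opposite w∈ x∈ wx) (proper _ _ w∈ y∈ wy)

    WeakSimplicial-addUniversal : ∀ {u₀ w} → u₀ ∈ S → (∀ x → x ∈ S → col x ≢ col u₀ → u₀ ~ x) →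
                                  WeakSimplicial G (S - u₀) w → WeakSimplicial G S w
    WeakSimplicial-addUniversal {u₀} {w} u₀∈ universal (w∈′ , _ , comparable) =
      w∈ , (λ x y x∈ wx y∈ wy xy → proper x y x∈ y∈ xy (sameColour w∈ x∈ y∈ wx wy)) , comparable′
      where
      w∈ : w ∈ S
      w∈ = p-x⊆p S w∈′

      u₀~N : ∀ {x z} → x ∈ S → z ∈ S → x ~ z → col x ≡ col u₀ → u₀ ~ z
      u₀~N x∈ z∈ xz x≡u₀ = universal _ z∈ (λ z≡u₀ → opposite x∈ z∈ xz (trans z≡u₀ (sym x≡u₀)))

      extend : ∀ {x y} → x ∈ S → y ∈ S → w ~ x → w ~ y →
               (∀ z → z ∈ S - u₀ → x ~ z → y ~ z) → ∀ z → z ∈ S → x ~ z → y ~ z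
      extend {x} {y} x∈ y∈ wx wy Nx⊆Ny z z∈ xz with z Fin.≟ u₀
      ... | yes refl =
        ~-sym (universal y y∈ λ y≡u₀ → opposite x∈ u₀∈ xz (sym (trans (sameColour w∈ x∈ y∈ wx wy) y≡u₀)))
      ... | no z≢u₀ = Nx⊆Ny z (x∈p∧x≢y⇒x∈p-y z∈ z≢u₀) xz

      comparable′ : ∀ x y → x ∈ S → w ~ x → y ∈ S → w ~ y → Comparable G S x y
      comparable′ x y x∈ wx y∈ wy with x Fin.≟ u₀ | y Fin.≟ u₀
      ... | yes refl | _ = inj₂ λ z z∈ yz → u₀~N y∈ z∈ yz (sameColour w∈ y∈ u₀∈ wy wx)
      ... | no _ | yes refl = inj₁ λ z z∈ xz → u₀~N x∈ z∈ xz (sameColour w∈ x∈ u₀∈ wx wy)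
      ... | no x≢u₀ | no y≢u₀ =
        Sum.map (extend x∈ y∈ wx wy) (extend y∈ x∈ wy wx)
                (comparable x y (x∈p∧x≢y⇒x∈p-y x∈ x≢u₀) wx (x∈p∧x≢y⇒x∈p-y y∈ y≢u₀) wy)

  Far : Subset n → Fin n → Fin n → Set
  Far S a x = x ∈ S × x ≢ a × ¬ (a ~ x)

  Far? : ∀ S a → Decidable (Far S a)
  Far? S a x = (x ∈? S) ×-dec (¬? (x Fin.≟ a) ×-dec ¬? (~-dec a x))

  far : Subset n → Fin n → Subset n
  far S a = subsetOf (Far? S a)

  module _ {S : Subset n} {a : Fin n} where

    far⁺ : ∀ {x} → x ∈ S → x ≢ a → ¬ (a ~ x) → x ∈ far S a
    far⁺ x∈ x≢a a≁x = ∈-subsetOf⁺ (Far? S a) (x∈ , x≢a , a≁x)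

    far⁻ : ∀ {x} → x ∈ far S a → Far S a x
    far⁻ = ∈-subsetOf⁻ (Far? S a)

    far⊆ : far S a ⊆ S
    far⊆ = proj₁ ∘ far⁻

    far⇒≢ : ∀ {x} → x ∈ far S a → x ≢ a
    far⇒≢ = proj₁ ∘ proj₂ ∘ far⁻

    far⇒≁ : ∀ {x} → x ∈ far S a → ¬ (a ~ x)
    far⇒≁ = proj₂ ∘ proj₂ ∘ far⁻

  module _ {S : Subset n} (proper : ProperColouring S) (noHole : NoLongInducedCycle G S)
           {a : Fin n} (a∈ : a ∈ S) {s p : Fin n} (p∈ : p ∈ S) (a~p : a ~ p)
           (W : Walk (far S a) s p) (ind : InducedPath (len W) (at W)) where

    private
      at-len′ : ∀ {t} → t ≡ len W → at W t ≡ p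
      at-len′ refl = at-len W

      at-cases : ∀ t → t ≤ len W → at W t ∈ far S a ⊎ at W t ≡ p
      at-cases t t≤len with m≤n⇒m<n∨m≡n t≤len
      ... | inj₁ t<len = inj₁ (at-∈ W t t<len)
      ... | inj₂ t≡len = inj₂ (at-len′ t≡len)

      at-∈S : ∀ t → t ≤ len W → at W t ∈ S
      at-∈S t t≤len = Sum.[ far⊆ , (λ at≡p → subst (_∈ S) (sym at≡p) p∈) ] (at-cases t t≤len)

      a≢at : ∀ t → t ≤ len W → a ≢ at W t
      a≢at t t≤len a≡at = Sum.[ (λ far∈ → far⇒≢ far∈ (sym a≡at)) ,
                                (λ at≡p → ~-irr (subst (a ~_) (sym (trans a≡at at≡p)) a~p)) ]
                              (at-cases t t≤len)

    module _ {q : Fin n} (q∈ : q ∈ S) (a~q : a ~ q) (q≢p : q ≢ p) {i : ℕ} (q~i : q ~ at W i) where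

      private
        q≡p-colour : col q ≡ col p
        q≡p-colour = sameColour proper a∈ q∈ p∈ a~q a~p

      -- a, q, at i, at (1 + i), p would be a 5-cycle
      ¬contact-2-before : i + 2 ≡ len W → ⊥
      ¬contact-2-before i+2≡len = proper x y x∈ y∈ x~y (≢-≢⇒≡ x≢p-colour p≢y-colour)
        where
        x = at W i
        y = at W (suc i)
        2+i≡len : suc (suc i) ≡ len W
        2+i≡len = trans (+-comm 2 i) i+2≡len
        1+i<len : suc i < len W
        1+i<len = ≤-reflexive 2+i≡len
        x∈ : x ∈ S
        x∈ = at-∈S i (<⇒≤ (<-trans (n<1+n i) 1+i<len))
        y∈ : y ∈ S
        y∈ = at-∈S (suc i) (<⇒≤ 1+i<len)
        x~y : x ~ y
        x~y = InducedPath.consecutive ind (<-trans (n<1+n i) 1+i<len)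
        y~p : y ~ p
        y~p = subst (y ~_) (at-len′ 2+i≡len) (InducedPath.consecutive ind 1+i<len)
        x≢p-colour : col x ≢ col p
        x≢p-colour x≡p = opposite proper q∈ x∈ q~i (trans x≡p (sym q≡p-colour))
        p≢y-colour : col p ≢ col y
        p≢y-colour = proper p y p∈ y∈ (~-sym y~p)

      -- a, q, at i, …, at (i + k) = p is an induced cycle of length k + 3
      ¬contact-far-before : ∀ {k} → i + suc (suc (suc k)) ≡ len W →
                            (∀ t → i < t → t ≤ len W → ¬ (q ~ at W t)) → ⊥
      ¬contact-far-before {k′} i+K≡len after = noHole (_ , m≤m+n 6 k′ , hole)
        where
        K : ℕ
        K = suc (suc (suc k′))
        v : ℕ → Fin n
        v t = at W (i + t)
        shift≤ : ∀ {t} → t ≤ K → i + t ≤ len W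
        shift≤ {t} t≤K = subst (i + t ≤_) i+K≡len (+-monoʳ-≤ i t≤K)
        shift< : ∀ {t} → t < K → i + t < len W
        shift< {t} t<K = subst (_≤ len W) (+-suc i t) (shift≤ t<K)
        q≢v : ∀ t → t ≤ K → q ≢ v t
        q≢v t t≤K q≡v = Sum.[ (λ v∈ → far⇒≁ v∈ (subst (a ~_) q≡v a~q)) ,
                              (λ v≡p → q≢p (trans q≡v v≡p)) ]
                            (at-cases (i + t) (shift≤ t≤K))
        q-path : InducedPath (suc K) (q ◃ v)
        q-path = InducedPath-◃ (InducedPath-drop ind i i+K≡len)
                   (subst (λ t → q ~ at W t) (sym (+-identityʳ i)) q~i)
                   (λ t 0<t t≤K → after (i + t) (m<m+n i 0<t) (shift≤ t≤K)) q≢v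
        q-path∈ : ∀ t → t ≤ suc K → (q ◃ v) t ∈ S
        q-path∈ zero _ = q∈
        q-path∈ (suc t) t≤K = at-∈S (i + t) (shift≤ (s≤s⁻¹ t≤K))
        a≁inner : ∀ t → 0 < t → t < suc K → ¬ (a ~ (q ◃ v) t)
        a≁inner (suc t) _ t<K = far⇒≁ (at-∈ W (i + t) (shift< (s≤s⁻¹ t<K)))
        a≢ : ∀ t → t ≤ suc K → a ≢ (q ◃ v) t
        a≢ zero _ a≡q = ~-irr (subst (a ~_) (sym a≡q) a~q)
        a≢ (suc t) t≤K = a≢at (i + t) (shift≤ (s≤s⁻¹ t≤K))
        hole : InducedCycle G S (suc (suc (suc K)))
        hole = closeInducedPath q-path q-path∈ a∈ a~q (subst (a ~_) (sym (at-len′ i+K≡len)) a~p) a≁inner a≢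

      lastContact : ∀ {k} → i + k ≡ len W → (∀ t → i < t → t ≤ len W → ¬ (q ~ at W t)) → k ≡ 1
      lastContact {zero} i+0≡len _ =
        ⊥-elim (proper q p q∈ p∈ (subst (q ~_) (at-len′ (trans (sym (+-identityʳ i)) i+0≡len)) q~i) q≡p-colour)
      lastContact {1} _ _ = refl
      lastContact {2} i+2≡len _ = ⊥-elim (¬contact-2-before i+2≡len)
      lastContact {suc (suc (suc k))} i+k≡len after = ⊥-elim (¬contact-far-before i+k≡len after)

  SimplicialFrom : Subset n → Fin n → Fin n → Set
  SimplicialFrom S a b = Σ[ w ∈ Fin n ] Reach (far S a) b w × WeakSimplicial G S w × col w ≢ col a

  module InductiveStep {S : Subset n} (proper : ProperColouring S) (noHole : NoLongInducedCycle G S)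
                       {a b : Fin n} (a∈ : a ∈ S) (b∈ : b ∈ S) (a≁b : ¬ (a ~ b)) (b≢a : col b ≢ col a)
                       (IH : ∀ {S′} → S′ ⊂ S → ∀ {a′ b′} → a′ ∈ S′ → b′ ∈ S′ → ¬ (a′ ~ b′) →
                             col b′ ≢ col a′ → SimplicialFrom S′ a′ b′) where

    T : Subset n
    T = far S a

    K : Fin n → Set
    K = Reach T b

    K? : Decidable K
    K? = Reach? T (⊂-wellFounded T) b

    b∈T : b ∈ T
    b∈T = far⁺ b∈ (b≢a ∘ cong col) a≁b

    T-closed : ∀ {w c} → w ∈ T → col w ≢ col a → c ∈ S → w ~ c → c ∈ T
    T-closed {w} {c} w∈T w≢a c∈ w~c = far⁺ c∈ c≢a (λ a~c → proper a c a∈ c∈ a~c (sym c≡a))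
      where
      c≡a : col c ≡ col a
      c≡a = ≢-≢⇒≡ (opposite proper (far⊆ w∈T) c∈ w~c) w≢a
      c≢a : c ≢ a
      c≢a refl = far⇒≁ w∈T (~-sym w~c)

    Near : Fin n → Set
    Near x = x ≡ a ⊎ K x ⊎ Σ[ c ∈ Fin n ] K c × x ~ c

    Near? : Decidable Near
    Near? x = (x Fin.≟ a) ⊎-dec (K? x ⊎-dec Fin.any? (λ c → K? c ×-dec ~-dec x c))

    region : Subset n
    region = subsetOf (λ x → (x ∈? S) ×-dec Near? x)

    region⁺ : ∀ {x} → x ∈ S → Near x → x ∈ region
    region⁺ x∈ near = ∈-subsetOf⁺ (λ x → (x ∈? S) ×-dec Near? x) (x∈ , near)

    region⁻ : ∀ {x} → x ∈ region → x ∈ S × Near x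
    region⁻ = ∈-subsetOf⁻ (λ x → (x ∈? S) ×-dec Near? x)

    -- Everything the weak-simpliciality of a vertex w of K on b's side depends on
    -- (its neighbours and their neighbours) stays inside the region.
    shrinkToRegion : ∀ {x} → x ∈ S → x ∉ region → SimplicialFrom S a b
    shrinkToRegion {x} x∈ x∉
      with IH (proj₁ ∘ region⁻ , x , x∈ , x∉) (region⁺ a∈ (inj₁ refl)) (region⁺ b∈ (inj₂ (inj₁ (here b∈T))))
              a≁b b≢a
    ... | w , b⇝w , w-simplicial , w≢a =
      w , Kw , WeakSimplicial-lift G (proj₁ ∘ region⁻) N⊆ N²⊆ w-simplicial , w≢a
      where
      farRegion⊆T : far region a ⊆ T
      farRegion⊆T y∈ with far⁻ y∈
      ... | y∈R , y≢a , a≁y = far⁺ (proj₁ (region⁻ y∈R)) y≢a a≁y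
      Kw : K w
      Kw = Reach-mono farRegion⊆T b⇝w
      N⊆ : ∀ y → y ∈ S → w ~ y → y ∈ region
      N⊆ y y∈ w~y = region⁺ y∈ (inj₂ (inj₂ (w , Kw , ~-sym w~y)))
      N²⊆ : ∀ c y → c ∈ S → w ~ c → y ∈ S → c ~ y → y ∈ region
      N²⊆ c y c∈ w~c y∈ c~y =
        region⁺ y∈ (inj₂ (inj₂ (c , Reach-snoc Kw w~c (T-closed (Reach-target∈ Kw) w≢a c∈ w~c) , ~-sym c~y)))

    module Covered (covered : ∀ x → x ∈ S → Near x) {c₀} (c₀∈ : c₀ ∈ S) (b~c₀ : b ~ c₀) where

      Candidate : Fin n → Set
      Candidate x = K x × col x ≡ col a

      Candidate? : Decidable Candidate
      Candidate? x = K? x ×-dec (col x Bool.≟ col a)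

      SharedWith : Fin n → Fin n → Set
      SharedWith x y = y ∈ S × a ~ y × x ~ y

      shared : Fin n → Subset n
      shared x = subsetOf (λ y → (y ∈? S) ×-dec (~-dec a y ×-dec ~-dec x y))

      shared⁺ : ∀ {x y} → SharedWith x y → y ∈ shared x
      shared⁺ {x} = ∈-subsetOf⁺ (λ y → (y ∈? S) ×-dec (~-dec a y ×-dec ~-dec x y))

      shared⁻ : ∀ {x y} → y ∈ shared x → SharedWith x y
      shared⁻ {x} = ∈-subsetOf⁻ (λ y → (y ∈? S) ×-dec (~-dec a y ×-dec ~-dec x y))

      c₀-candidate : Candidate c₀
      c₀-candidate = Reach-snoc (here b∈T) b~c₀ (T-closed b∈T b≢a c₀∈ b~c₀)
                   , ≢-≢⇒≡ (opposite proper b∈ c₀∈ b~c₀) b≢a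

      module Maximal {a′ : Fin n} (Ka′ : K a′) (a′≡a : col a′ ≡ col a)
                     (a′-max : ∀ y → Candidate y → ∣ shared y ∣ ≤ ∣ shared a′ ∣) where

        a′∈T : a′ ∈ T
        a′∈T = Reach-target∈ Ka′

        a′∈ : a′ ∈ S
        a′∈ = far⊆ a′∈T

        a′≢a : a′ ≢ a
        a′≢a = far⇒≢ a′∈T

        module _ {p : Fin n} (p∈ : p ∈ S) (a~p : a ~ p) (a′≁p : ¬ (a′ ~ p))
                 (W : Walk T a′ p) (ind : InducedPath (len W) (at W)) where

          private
            a′≢p : a′ ≢ p
            a′≢p a′≡p = far⇒≁ a′∈T (subst (a ~_) (sym a′≡p) a~p)

            nonempty : Σ[ r ∈ ℕ ] suc r ≡ len W
            nonempty = m≤n⇒∃[o]m+o≡n (n≢0⇒n>0 λ len≡0 →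
                         a′≢p (trans (sym (at-0 W)) (trans (cong (at W) (sym len≡0)) (at-len W))))

            r : ℕ
            r = proj₁ nonempty

            r<len : r < len W
            r<len = ≤-reflexive (proj₂ nonempty)

            u : Fin n
            u = at W r

            u∈ : u ∈ S
            u∈ = far⊆ (at-∈ W r r<len)

            u~p : u ~ p
            u~p = subst (u ~_) (trans (cong (at W) (proj₂ nonempty)) (at-len W)) (at-~ W r r<len)

            u-candidate : Candidate u
            u-candidate = Reach-trans Ka′ (Walk⇒Reach W r r<len)
                        , ≢-≢⇒≡ (proper u p u∈ p∈ u~p) (opposite proper a∈ p∈ a~p)

            u-sees : ∀ {q} → SharedWith a′ q → u ~ q
            u-sees {q} (q∈ , a~q , a′~q)
              with lastUpTo (λ t → ~-dec q (at W t)) (len W) (subst (q ~_) (sym (at-0 W)) (~-sym a′~q))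
            ... | i , i≤len , q~i , after with m≤n⇒∃[o]m+o≡n i≤len
            ...   | k , i+k≡len
              with lastContact proper noHole a∈ p∈ a~p W ind q∈ a~q (a′≁p ∘ λ q≡p → subst (a′ ~_) q≡p a′~q)
                               q~i i+k≡len after
            ...     | refl = ~-sym (subst (λ t → q ~ at W t) i≡r q~i)
              where
              i≡r : i ≡ r
              i≡r = suc-injective (trans (+-comm 1 i) (trans i+k≡len (sym (proj₂ nonempty))))

            shared-a′⊂shared-u : shared a′ ⊂ shared u
            shared-a′⊂shared-u =
                (λ q∈ → let (q∈S , a~q , a′~q) = shared⁻ q∈ in shared⁺ (q∈S , a~q , u-sees (q∈S , a~q , a′~q)))
              , p , shared⁺ (p∈ , a~p , u~p) , (λ p∈′ → a′≁p (proj₂ (proj₂ (shared⁻ p∈′))))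

          a′-notMaximal : ⊥
          a′-notMaximal = <⇒≱ (p⊂q⇒∣p∣<∣q∣ shared-a′⊂shared-u) (a′-max u u-candidate)

        a′-dominates : ∀ {p} → p ∈ S → a ~ p → a′ ~ p
        a′-dominates {p} p∈ a~p with ~-dec a′ p | covered p p∈
        ... | yes a′~p | _ = a′~p
        ... | no _ | inj₁ refl = ⊥-elim (~-irr a~p)
        ... | no _ | inj₂ (inj₁ Kp) = ⊥-elim (far⇒≁ (Reach-target∈ Kp) a~p)
        ... | no a′≁p | inj₂ (inj₂ (c , Kc , p~c)) =
          ⊥-elim (uncurry (a′-notMaximal p∈ a~p a′≁p)
                    (inducedWalk (Reach⇒Walk (Reach-trans (Reach-sym Ka′) Kc) (~-sym p~c)) (<-wellFounded _)))

        -- Some vertex of K on b's side is missed by a′: recurse on S - a from a′ (which sees all of N(a)).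
        fromMissed : ∀ {b₁} → K b₁ → col b₁ ≢ col a → ¬ (a′ ~ b₁) → SimplicialFrom S a b
        fromMissed {b₁} Kb₁ b₁≢a a′≁b₁
          with IH (x∈p⇒p-x⊂p a∈) (x∈p∧x≢y⇒x∈p-y a′∈ a′≢a)
                  (x∈p∧x≢y⇒x∈p-y (far⊆ (Reach-target∈ Kb₁)) (far⇒≢ (Reach-target∈ Kb₁)))
                  a′≁b₁ (λ b₁≡a′ → b₁≢a (trans b₁≡a′ a′≡a))
        ... | w , b₁⇝w , w-simplicial , w≢a′ =
            w , Reach-trans Kb₁ (Reach-mono far⊆T b₁⇝w)
          , WeakSimplicial-lift G (p-x⊆p S) N⊆ N²⊆ w-simplicial , w≢a
          where
          w≢a : col w ≢ col a
          w≢a w≡a = w≢a′ (trans w≡a (sym a′≡a))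
          far⊆T : far (S - a) a′ ⊆ T
          far⊆T x∈ with far⁻ x∈
          ... | x∈′ , _ , a′≁x = far⁺ (p-x⊆p S x∈′) (x∈p-y⇒x≢y S x∈′) (a′≁x ∘ a′-dominates (p-x⊆p S x∈′))
          w∈T : w ∈ T
          w∈T = far⊆T (Reach-target∈ b₁⇝w)
          N⊆ : ∀ x → x ∈ S → w ~ x → x ∈ S - a
          N⊆ x x∈ w~x = x∈p∧x≢y⇒x∈p-y x∈ λ { refl → far⇒≁ w∈T (~-sym w~x) }
          N²⊆ : ∀ c x → c ∈ S → w ~ c → x ∈ S → c ~ x → x ∈ S - a
          N²⊆ c x c∈ w~c x∈ c~x = x∈p∧x≢y⇒x∈p-y x∈ λ { refl → proper c a c∈ a∈ c~x c≡a }
            where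
            c≡a : col c ≡ col a
            c≡a = ≢-≢⇒≡ (opposite proper (far⊆ w∈T) c∈ w~c) w≢a

        -- a′ sees all of K on b's side, hence every vertex of S on b's side: recurse on S - a′.
        fromUniversal : (∀ {x} → K x → col x ≢ col a → a′ ~ x) → SimplicialFrom S a b
        fromUniversal a′~K
          with IH (x∈p⇒p-x⊂p a′∈) (x∈p∧x≢y⇒x∈p-y a∈ (a′≢a ∘ sym))
                  (x∈p∧x≢y⇒x∈p-y b∈ (λ b≡a′ → b≢a (trans (cong col b≡a′) a′≡a))) a≁b b≢a
        ... | w , b⇝w , w-simplicial , w≢a =
          w , Reach-mono far⊆T b⇝w , WeakSimplicial-addUniversal proper a′∈ universal w-simplicial , w≢a
          where
          far⊆T : far (S - a′) a ⊆ T
          far⊆T x∈ with far⁻ x∈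
          ... | x∈′ , x≢a , a≁x = far⁺ (p-x⊆p S x∈′) x≢a a≁x
          universal : ∀ x → x ∈ S → col x ≢ col a′ → a′ ~ x
          universal x x∈ x≢a′ with covered x x∈
          ... | inj₁ refl = ⊥-elim (x≢a′ (sym a′≡a))
          ... | inj₂ (inj₁ Kx) = a′~K Kx (λ x≡a → x≢a′ (trans x≡a (sym a′≡a)))
          ... | inj₂ (inj₂ (c , Kc , x~c)) with ~-dec a x
          ...   | yes a~x = a′-dominates x∈ a~x
          ...   | no a≁x = a′~K (Reach-snoc Kc (~-sym x~c) x∈T) (λ x≡a → x≢a′ (trans x≡a (sym a′≡a)))
            where
            x∈T : x ∈ T
            x∈T = far⁺ x∈ (λ { refl → x≢a′ (sym a′≡a) }) a≁x

        result : SimplicialFrom S a b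
        result with Fin.any? (λ b₁ → K? b₁ ×-dec (¬? (col b₁ Bool.≟ col a) ×-dec ¬? (~-dec a′ b₁)))
        ... | yes (b₁ , Kb₁ , b₁≢a , a′≁b₁) = fromMissed Kb₁ b₁≢a a′≁b₁
        ... | no none = fromUniversal a′~K
          where
          a′~K : ∀ {x} → K x → col x ≢ col a → a′ ~ x
          a′~K {x} Kx x≢a with ~-dec a′ x
          ... | yes a′~x = a′~x
          ... | no a′≁x = ⊥-elim (none (x , Kx , x≢a , a′≁x))

      result : SimplicialFrom S a b
      result with argmax-Fin Candidate? (λ x → ∣ shared x ∣) (c₀ , c₀-candidate)
      ... | a′ , (Ka′ , a′≡a) , a′-max = Maximal.result Ka′ a′≡a a′-max

    result : SimplicialFrom S a b
    result with Fin.any? (λ c → (c ∈? S) ×-dec ~-dec b c)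
    ... | no b-isolated =
      b , here b∈T , WeakSimplicial-isolated G b∈ (λ c c∈ b~c → b-isolated (c , c∈ , b~c)) , b≢a
    ... | yes (c₀ , c₀∈ , b~c₀) with Fin.any? (λ x → (x ∈? S) ×-dec ¬? (x ∈? region))
    ...   | yes (x , x∈ , x∉) = shrinkToRegion x∈ x∉
    ...   | no noneOutside = Covered.result covered c₀∈ b~c₀
      where
      covered : ∀ x → x ∈ S → Near x
      covered x x∈ with x ∈? region
      ... | yes x∈R = proj₂ (region⁻ x∈R)
      ... | no x∉R = ⊥-elim (noneOutside (x , x∈ , x∉R))

  simplicialFrom : ∀ {S} → Acc _⊂_ S → ProperColouring S → NoLongInducedCycle G S →
                   ∀ {a b} → a ∈ S → b ∈ S → ¬ (a ~ b) → col b ≢ col a → SimplicialFrom S a b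
  simplicialFrom {S} (acc smaller) proper noHole a∈ b∈ a≁b b≢a =
    InductiveStep.result proper noHole a∈ b∈ a≁b b≢a IH
    where
    IH : ∀ {S′} → S′ ⊂ S → ∀ {a′ b′} → a′ ∈ S′ → b′ ∈ S′ → ¬ (a′ ~ b′) → col b′ ≢ col a′ →
         SimplicialFrom S′ a′ b′
    IH S′⊂S@(S′⊆S , _) =
      simplicialFrom (smaller S′⊂S) (ProperColouring-⊆ S′⊆S proper) (NoLongInducedCycle-⊆ G S′⊆S noHole)

  weakSimplicial-exists : ∀ {S} → Acc _⊂_ S → ProperColouring S → NoLongInducedCycle G S → Nonempty S →
                          ∃ (WeakSimplicial G S)
  weakSimplicial-exists {S} rec@(acc smaller) proper noHole (v , v∈)
    with Fin.any? (λ b → (b ∈? S) ×-dec (¬? (col b Bool.≟ col v) ×-dec ¬? (~-dec v b)))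
  ... | yes (b , b∈ , b≢v , v≁b) with simplicialFrom rec proper noHole v∈ b∈ v≁b b≢v
  ...   | w , _ , w-simplicial , _ = w , w-simplicial
  weakSimplicial-exists {S} (acc smaller) proper noHole (v , v∈) | no v-universal
    with Fin.any? (λ x → (x ∈? S) ×-dec ¬? (x Fin.≟ v))
  ... | no alone = v , WeakSimplicial-isolated G v∈ (λ x x∈ v~x → alone (x , x∈ , λ { refl → ~-irr v~x }))
  ... | yes (x , x∈ , x≢v)
    with weakSimplicial-exists (smaller (x∈p⇒p-x⊂p v∈)) (ProperColouring-⊆ (p-x⊆p S) proper)
                               (NoLongInducedCycle-⊆ G (p-x⊆p S) noHole) (x , x∈p∧x≢y⇒x∈p-y x∈ x≢v)
  ...   | w , w-simplicial = w , WeakSimplicial-addUniversal proper v∈ universal w-simplicial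
    where
    universal : ∀ y → y ∈ S → col y ≢ col v → v ~ y
    universal y y∈ y≢v with ~-dec v y
    ... | yes v~y = v~y
    ... | no v≁y = ⊥-elim (v-universal (y , y∈ , y≢v , v≁y))

module _ {n : ℕ} (G : SimpleGraph n) where
  open SimpleGraph G

  Solution-⊆ : ∀ {X Y} → Y ⊆ X → Solution G X → Solution G Y
  Solution-⊆ Y⊆X ((col , proper) , noHole) =
    (col , Colouring.ProperColouring-⊆ G col Y⊆X proper) , NoLongInducedCycle-⊆ G Y⊆X noHole

  Solution-∅ : Solution G ∅
  Solution-∅ = ((λ _ → true) , λ u _ u∈ → ⊥-elim (∉⊥ u∈)) , λ { (suc k , _ , c , _ , c∈ , _) → ∉⊥ (c∈ zero) }

  parentVertex : ∀ {X} → Solution G X → Nonempty X → Σ[ v ∈ Fin n ] IsParentVertex G X v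
  parentVertex {X} ((col , proper) , noHole) nonempty = argmax-Fin (WeakSimplicial? G X) toℕ
    (Colouring.weakSimplicial-exists G col (⊂-wellFounded X) proper noHole nonempty)

  parentVertex-unique : ∀ {X v v′} → IsParentVertex G X v → IsParentVertex G X v′ → v ≡ v′
  parentVertex-unique (v-ws , v-max) (v′-ws , v′-max) =
    Fin.toℕ-injective (≤-antisym (v′-max _ v-ws) (v-max _ v′-ws))

  parentArc : ∀ {X} → Solution G X → Nonempty X → ∃ (FTArc G X)
  parentArc {X} sol nonempty with parentVertex sol nonempty
  ... | v , v-parent = X - v , sol , nonempty , v , v-parent , refl

  FTArc-Solution : ∀ {X Y} → FTArc G X Y → Solution G Y
  FTArc-Solution {X} (sol , _ , _ , _ , refl) = Solution-⊆ (p-x⊆p X) sol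

  FTArc-⊂ : ∀ {X Y} → FTArc G X Y → Y ⊂ X
  FTArc-⊂ (_ , _ , _ , ((v∈ , _) , _) , refl) = x∈p⇒p-x⊂p v∈

  reachesRoot : ∀ {X} → Acc _⊂_ X → Solution G X → Star (FTArc G) X ∅
  reachesRoot {X} (acc smaller) sol with nonempty? X
  ... | no empty = subst (λ Z → Star (FTArc G) Z ∅) (sym (Empty-unique empty)) ε
  ... | yes nonempty with parentArc sol nonempty
  ...   | Y , arc = arc ◅ reachesRoot (smaller (FTArc-⊂ arc)) (FTArc-Solution arc)

lemma4 : (n : ℕ) (G : SimpleGraph n) → FamilyTreeIsTree G
lemma4 n G = record
  { root∈ = Solution-∅ G
  ; arc-src = proj₁
  ; arc-tgt = FTArc-Solution G
  ; root-sink = λ { (_ , (_ , x∈∅) , _) → ∉⊥ x∈∅ }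
  ; out-exists = λ X sol X≢∅ → parentArc G sol (≢∅⇒Nonempty X≢∅)
  ; out-unique = λ { {X} (_ , _ , _ , v-parent , refl) (_ , _ , _ , v′-parent , refl) →
                       cong (X -_) (parentVertex-unique G v-parent v′-parent) }
  ; reach-root = λ X sol → reachesRoot G (⊂-wellFounded X) sol
  }
  where
  ≢∅⇒Nonempty : ∀ {X : Subset n} → X ≢ ∅ → Nonempty X
  ≢∅⇒Nonempty {X} X≢∅ with nonempty? X
  ... | yes nonempty = nonempty
  ... | no empty = ⊥-elim (X≢∅ (Empty-unique empty))
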